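{- Let $S$ be a set of points of $\mathrm{PG}(N,q)$. Then $S$ is a cutting blocking set if and only if for every hyperplane $\Lambda$ of $\mathrm{PG}(N,q)$, the point set $S\setminus\Lambda\subseteq \mathrm{PG}(N,q)\setminus\Lambda\simeq\mathrm{AG}(N,q)$ is an affine blocking set with respect to hyperplanes, i.e. $S\setminus\Lambda$ meets every hyperplane of $\mathrm{PG}(N,q)$ other than $\Lambda$.
   Context: $\mathrm{PG}(N,q)$ is the $N$-dimensional projective space over $\mathbb{F}_q$. A cutting blocking set of $\mathrm{PG}(N,q)$ is a point set $S$ such that for every hyperplane $H$, the set $S\cap H$ spans $H$. -}

module Defs where

open import Level using (Level; _⊔_; suc)
open import Data.Nat using (ℕ) renaming (suc to sucℕ)
open import Data.Fin using (Fin) renaming (zero to fzero; suc to fsuc)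
open import Data.Product using (Σ; ∃; _×_; _,_)
open import Relation.Nullary using (¬_)
open import Algebra.Bundles using (CommutativeRing)
open import Relation.Binary.PropositionalEquality using (_≡_)

record Field (c ℓ : Level) : Set (suc (c ⊔ ℓ)) where
  field
    commRing : CommutativeRing c ℓ
  open CommutativeRing commRing public
  field
    0≉1      : ¬ (0# ≈ 1#)
    inverse  : ∀ x → ¬ (x ≈ 0#) → ∃ λ y → (x * y) ≈ 1#

record HasOrder {c ℓ} (F : Field c ℓ) (q : ℕ) : Set (c ⊔ ℓ) where
  open Field F
  field
    enum       : Fin q → Carrier
    enum-inj   : ∀ i j → enum i ≈ enum j → i ≡ j
    enum-surj  : ∀ x → ∃ λ i → enum i ≈ x

module Proj {c ℓ} (F : Field c ℓ) (N : ℕ) where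
  open Field F

  -- Vectors of the underlying vector space F^{N+1} of PG(N, F).
  V : Set c
  V = Fin (sucℕ N) → Carrier

  Σᶠ : ∀ {k} → (Fin k → Carrier) → Carrier
  Σᶠ {ℕ.zero}  f = 0#
  Σᶠ {sucℕ k}  f = f fzero + Σᶠ (λ i → f (fsuc i))

  _≋_ : V → V → Set ℓ
  v ≋ w = ∀ i → v i ≈ w i

  IsZero : V → Set ℓ
  IsZero v = ∀ i → v i ≈ 0#

  _∼_ : V → V → Set (c ⊔ ℓ)
  v ∼ w = ∃ λ μ → ¬ (μ ≈ 0#) × (∀ i → w i ≈ (μ * v i))

  -- A set of points of PG(N,q): a predicate on vectors, containing only
  -- nonzero vectors, and closed under projective equivalence.
  record IsPointSet {p} (S : V → Set p) : Set (c ⊔ ℓ ⊔ p) where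
    field
      nonzero : ∀ v → S v → ¬ IsZero v
      closed  : ∀ v w → v ∼ w → S v → S w

  -- Hyperplanes are given by nonzero linear functionals a (coordinate vectors);
  -- the point ⟨v⟩ lies on the hyperplane H_a iff a·v = 0.
  _·_ : V → V → Carrier
  a · v = Σᶠ (λ i → a i * v i)

  OnHyp : V → V → Set ℓ
  OnHyp a v = (a · v) ≈ 0#

  IsHyperplane : V → Set ℓ
  IsHyperplane a = ¬ IsZero a

  SameHyperplane : V → V → Set (c ⊔ ℓ)
  SameHyperplane a b = ∀ v → ¬ IsZero v → (OnHyp a v → OnHyp b v) × (OnHyp b v → OnHyp a v)

  InSpan : ∀ {p} → (V → Set p) → V → Set (c ⊔ ℓ ⊔ p)
  InSpan P w = Σ ℕ λ k → Σ (Fin k → V) λ u → Σ (Fin k → Carrier) λ μ →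
    (∀ j → P (u j)) × (∀ i → w i ≈ Σᶠ (λ j → μ j * u j i))

  Spans : ∀ {p} → (V → Set p) → V → Set (c ⊔ ℓ ⊔ p)
  Spans S a = ∀ w → OnHyp a w → InSpan (λ v → S v × OnHyp a v) w

  IsCutting : ∀ {p} → (V → Set p) → Set (c ⊔ ℓ ⊔ p)
  IsCutting S = ∀ a → IsHyperplane a → Spans S a

  AffineBlocking : ∀ {p} → (V → Set p) → V → Set (c ⊔ ℓ ⊔ p)
  AffineBlocking S a = ∀ b → IsHyperplane b → ¬ SameHyperplane a b →
    ∃ λ v → S v × ¬ OnHyp a v × OnHyp b v

-- Over a field with decidable equality (a finite field has one), the vectors of a set T
-- lying in the kernel K of a functional a span K as soon as no functional that is
-- nonzero on K vanishes on all of them.  This is Gaussian elimination by induction on the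
-- dimension: either K contains a vector with nonzero first coordinate, and then so does
-- T, and projecting along such a vector v₀ ∈ T reduces to the kernel of the tail of a;
-- or K lies in the coordinate hyperplane x₀ = 0 and the first coordinate can be dropped.
-- That S ∖ H_b meets H_a for every hyperplane H_b ≠ H_a says precisely that S ∩ H_a
-- passes this test, so S ∩ H_a spans H_a.  Conversely, if H_b ≠ H_a, some w ∈ H_b lies
-- off H_a; writing w as a combination of vectors of S ∩ H_b, one of them lies off H_a.
module Submission where

open import Defs
open import Level using (Level; _⊔_)
open import Data.Nat using (ℕ; zero; suc)
open import Data.Fin using (Fin; zero; suc)
open import Data.Fin.Properties using (all?; ¬∀⟶∃¬)
import Data.Fin.Properties as Fin
open import Data.Product using (Σ; ∃; _×_; _,_; proj₁; proj₂; map₂)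
open import Data.Sum using (_⊎_; inj₁; inj₂)
open import Data.Empty using (⊥-elim)
open import Data.Vec.Functional using (Vector; _∷_; tail)
open import Function using (_∘_)
open import Relation.Nullary using (¬_; yes; no)
open import Relation.Binary.Definitions using (Decidable)
open import Relation.Binary.PropositionalEquality using (_≡_; cong; subst) renaming (refl to ≡-refl; sym to ≡-sym)

module _ {c ℓ} {F : Field c ℓ} {q : ℕ} (H : HasOrder F q) where
  open Field F hiding (zero)
  open HasOrder H

  finite⇒decidable : Decidable _≈_
  finite⇒decidable x y with enum-surj x | enum-surj y
  ... | i , eᵢ≈x | j , eⱼ≈y with i Fin.≟ j
  ... | yes ≡-refl = yes (trans (sym eᵢ≈x) eⱼ≈y)
  ... | no i≢j = no λ x≈y → i≢j (enum-inj i j (trans eᵢ≈x (trans x≈y (sym eⱼ≈y))))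

module FieldProperties {c ℓ} (F : Field c ℓ) where
  open Field F hiding (zero)
  open import Relation.Binary.Reasoning.Setoid setoid

  inv : ∀ x → ¬ x ≈ 0# → Carrier
  inv x x≉0 = proj₁ (inverse x x≉0)

  *-inv-cancelʳ : ∀ y {x} (x≉0 : ¬ x ≈ 0#) → (y * inv x x≉0) * x ≈ y
  *-inv-cancelʳ y {x} x≉0 = begin
    (y * inv x x≉0) * x  ≈⟨ *-assoc y _ x ⟩
    y * (inv x x≉0 * x)  ≈⟨ *-congˡ (trans (*-comm _ x) (proj₂ (inverse x x≉0))) ⟩
    y * 1#               ≈⟨ *-identityʳ y ⟩
    y                    ∎

  *-cancelˡ : ∀ {x y z} → ¬ x ≈ 0# → x * y ≈ x * z → y ≈ z
  *-cancelˡ {x} {y} {z} x≉0 xy≈xz = begin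
    y                    ≈⟨ *-inv-cancelʳ y x≉0 ⟨
    (y * inv x x≉0) * x  ≈⟨ *-congʳ (*-comm y _) ⟩
    (inv x x≉0 * y) * x  ≈⟨ *-assoc _ y x ⟩
    inv x x≉0 * (y * x)  ≈⟨ *-congˡ (trans (*-comm y x) (trans xy≈xz (*-comm x z))) ⟩
    inv x x≉0 * (z * x)  ≈⟨ *-assoc _ z x ⟨
    (inv x x≉0 * z) * x  ≈⟨ *-congʳ (*-comm _ z) ⟩
    (z * inv x x≉0) * x  ≈⟨ *-inv-cancelʳ z x≉0 ⟩
    z                    ∎

  zero-product : ∀ {x y} → ¬ x ≈ 0# → x * y ≈ 0# → y ≈ 0#
  zero-product {x} x≉0 xy≈0 = *-cancelˡ x≉0 (trans xy≈0 (sym (zeroʳ x)))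

module LinearAlgebra {c ℓ} (F : Field c ℓ) (_≟_ : Decidable (Field._≈_ F)) where
  open Field F hiding (zero)
  open FieldProperties F
  open import Algebra.Properties.Semiring.Sum semiring
    using (sum; sum-cong-≋; sum-replicate-zero; ∑-distrib-+; ∑-comm; *-distribˡ-sum; *-distribʳ-sum)
  open import Algebra.Properties.Ring ring using (-‿distribˡ-*; -‿distribʳ-*)
  open import Algebra.Properties.Group +-group using (x∙y⁻¹≈ε⇒x≈y)
  open import Data.Vec.Functional.Relation.Binary.Equality.Setoid setoid using (_≋_)
  open import Relation.Binary.Reasoning.Setoid setoid
  open import Algebra.Solver.Ring.NaturalCoefficients.Default commutativeSemiring using (solve; _:=_; _:+_; _:*_)

  private variable
    m n k : ℕ
    p p′ : Level

  infix 8 _·_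
  _·_ : Vector Carrier n → Vector Carrier n → Carrier
  a · v = sum (λ i → a i * v i)

  infix 4 _⊥_
  _⊥_ : Vector Carrier n → Vector Carrier n → Set ℓ
  a ⊥ v = a · v ≈ 0#

  δ : Fin n → Vector Carrier n
  δ zero    zero    = 1#
  δ zero    (suc _) = 0#
  δ (suc _) zero    = 0#
  δ (suc i) (suc j) = δ i j

  lincomb : Vector Carrier k → (Fin k → Vector Carrier n) → Vector Carrier n
  lincomb μ u i = sum (λ j → μ j * u j i)

  InSpan : (Vector Carrier n → Set p) → Vector Carrier n → Set (c ⊔ ℓ ⊔ p)
  InSpan {n} P w = Σ ℕ λ k → Σ (Fin k → Vector Carrier n) λ u → Σ (Vector Carrier k) λ μ →
    (∀ j → P (u j)) × w ≋ lincomb μ u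

  InSpan-mono : {P Q : Vector Carrier n → Set p} → (∀ {v} → P v → Q v) →
                ∀ {w} → InSpan P w → InSpan Q w
  InSpan-mono P⇒Q (k , u , μ , u∈P , w≋) = k , u , μ , P⇒Q ∘ u∈P , w≋

  _∩ker_ : (Vector Carrier n → Set p) → Vector Carrier n → Vector Carrier n → Set (ℓ ⊔ p)
  (T ∩ker a) v = T v × a ⊥ v

  Image : (Vector Carrier m → Vector Carrier n) → (Vector Carrier m → Set p) →
          Vector Carrier n → Set (c ⊔ ℓ ⊔ p)
  Image π P u = ∃ λ v → P v × u ≋ π v

  sum-zero : {f : Vector Carrier n} → (∀ i → f i ≈ 0#) → sum f ≈ 0#
  sum-zero {n} f≈0 = trans (sum-cong-≋ f≈0) (sum-replicate-zero n)

  sum-nonzero : (f : Vector Carrier n) → ¬ sum f ≈ 0# → ∃ λ j → ¬ f j ≈ 0#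
  sum-nonzero {n} f Σf≉0 = ¬∀⟶∃¬ n _ (λ j → f j ≟ 0#) (Σf≉0 ∘ sum-zero)

  ·-congʳ : (y : Vector Carrier n) {u v : Vector Carrier n} → u ≋ v → y · u ≈ y · v
  ·-congʳ y u≋v = sum-cong-≋ (λ i → *-congˡ (u≋v i))

  ·-congˡ : {y z : Vector Carrier n} (v : Vector Carrier n) → y ≋ z → y · v ≈ z · v
  ·-congˡ v y≋z = sum-cong-≋ (λ i → *-congʳ (y≋z i))

  ·-zeroˡ : {y : Vector Carrier n} (v : Vector Carrier n) → (∀ i → y i ≈ 0#) → y ⊥ v
  ·-zeroˡ v y≈0 = sum-zero (λ i → trans (*-congʳ (y≈0 i)) (zeroˡ (v i)))

  ·-zeroʳ : (y : Vector Carrier n) {v : Vector Carrier n} → (∀ i → v i ≈ 0#) → y ⊥ v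
  ·-zeroʳ y v≈0 = sum-zero (λ i → trans (*-congˡ (v≈0 i)) (zeroʳ (y i)))

  ·-+ʳ : (y u v : Vector Carrier n) → y · (λ i → u i + v i) ≈ y · u + y · v
  ·-+ʳ y u v = trans (sum-cong-≋ (λ i → distribˡ (y i) (u i) (v i)))
                     (∑-distrib-+ (λ i → y i * u i) (λ i → y i * v i))

  ·-*ʳ : (y : Vector Carrier n) (x : Carrier) (v : Vector Carrier n) → y · (λ i → x * v i) ≈ x * (y · v)
  ·-*ʳ y x v = begin
    sum (λ i → y i * (x * v i))
      ≈⟨ sum-cong-≋ (λ i → solve 3 (λ Y X V → (Y :* (X :* V)) := (X :* (Y :* V))) refl (y i) x (v i)) ⟩
    sum (λ i → x * (y i * v i))  ≈⟨ *-distribˡ-sum x (λ i → y i * v i) ⟨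
    x * (y · v)                  ∎

  ·-*ˡ : (x : Carrier) (y v : Vector Carrier n) → (λ i → x * y i) · v ≈ x * (y · v)
  ·-*ˡ x y v = trans (sum-cong-≋ (λ i → *-assoc x (y i) (v i))) (sym (*-distribˡ-sum x (λ i → y i * v i)))

  ·-+*ʳ : (y u : Vector Carrier n) (x : Carrier) (v : Vector Carrier n) →
          y · (λ i → u i + x * v i) ≈ y · u + x * (y · v)
  ·-+*ʳ y u x v = trans (·-+ʳ y u _) (+-congˡ (·-*ʳ y x v))

  ·-δʳ : (y : Vector Carrier n) (i : Fin n) → y · δ i ≈ y i
  ·-δʳ y zero = begin
    y zero * 1# + sum (λ j → y (suc j) * 0#)  ≈⟨ +-cong (*-identityʳ _) (·-zeroʳ (tail y) (λ _ → refl)) ⟩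
    y zero + 0#                               ≈⟨ +-identityʳ _ ⟩
    y zero                                    ∎
  ·-δʳ y (suc i) = begin
    y zero * 0# + tail y · δ i  ≈⟨ +-congʳ (zeroʳ _) ⟩
    0# + tail y · δ i           ≈⟨ +-identityˡ _ ⟩
    tail y · δ i                ≈⟨ ·-δʳ (tail y) i ⟩
    y (suc i)                   ∎

  ·-δˡ : (i : Fin n) (v : Vector Carrier n) → δ i · v ≈ v i
  ·-δˡ i v = trans (sum-cong-≋ (λ j → *-comm (δ i j) (v j))) (·-δʳ v i)

  ·-zero-headʳ : (y x : Vector Carrier (suc n)) → x zero ≈ 0# → y · x ≈ tail y · tail x
  ·-zero-headʳ y x x₀≈0 = trans (+-congʳ (trans (*-congˡ x₀≈0) (zeroʳ (y zero)))) (+-identityˡ _)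

  ·-lincomb : (y : Vector Carrier n) (μ : Vector Carrier k) (u : Fin k → Vector Carrier n) →
              y · lincomb μ u ≈ sum (λ j → μ j * (y · u j))
  ·-lincomb y μ u = begin
    sum (λ i → y i * sum (λ j → μ j * u j i))
      ≈⟨ sum-cong-≋ (λ i → *-distribˡ-sum (y i) (λ j → μ j * u j i)) ⟩
    sum (λ i → sum (λ j → y i * (μ j * u j i)))  ≈⟨ ∑-comm (λ i j → y i * (μ j * u j i)) ⟩
    sum (λ j → sum (λ i → y i * (μ j * u j i)))  ≈⟨ sum-cong-≋ (λ j → ·-*ʳ y (μ j) (u j)) ⟩
    sum (λ j → μ j * (y · u j))                  ∎

  x+-y*z+y*z≈x : ∀ x y z → x + (- y) * z + y * z ≈ x
  x+-y*z+y*z≈x x y z = begin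
    x + (- y) * z + y * z    ≈⟨ +-assoc x _ _ ⟩
    x + ((- y) * z + y * z)  ≈⟨ +-congˡ (distribʳ z (- y) y) ⟨
    x + (- y + y) * z        ≈⟨ +-congˡ (trans (*-congʳ (-‿inverseˡ y)) (zeroˡ z)) ⟩
    x + 0#                   ≈⟨ +-identityʳ x ⟩
    x                        ∎

  sum-lincomb-shift : (μ d x : Vector Carrier k) (z : Carrier) →
    sum (λ j → μ j * (x j + (- d j) * z)) + sum (λ j → μ j * d j) * z ≈ sum (λ j → μ j * x j)
  sum-lincomb-shift μ d x z = begin
    sum (λ j → μ j * (x j + (- d j) * z)) + sum (λ j → μ j * d j) * z
      ≈⟨ +-congˡ (*-distribʳ-sum z (λ j → μ j * d j)) ⟩
    sum (λ j → μ j * (x j + (- d j) * z)) + sum (λ j → μ j * d j * z)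
      ≈⟨ ∑-distrib-+ (λ j → μ j * (x j + (- d j) * z)) (λ j → μ j * d j * z) ⟨
    sum (λ j → μ j * (x j + (- d j) * z) + μ j * d j * z)
      ≈⟨ sum-cong-≋ (λ j → shift-term (μ j) (d j) (x j)) ⟩
    sum (λ j → μ j * x j) ∎
    where
    shift-term : ∀ m e y → m * (y + (- e) * z) + m * e * z ≈ m * y
    shift-term m e y = begin
      m * (y + (- e) * z) + m * e * z
        ≈⟨ solve 5 (λ M E E′ Y Z → (M :* (Y :+ E′ :* Z) :+ M :* E :* Z)
                                 := (M :* Y :+ (M :* E′) :* Z :+ (M :* E) :* Z))
                   refl m e (- e) y z ⟩
      m * y + (m * - e) * z + m * e * z  ≈⟨ +-congʳ (+-congˡ (*-congʳ (-‿distribʳ-* m e))) ⟨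
      m * y + (- (m * e)) * z + m * e * z ≈⟨ x+-y*z+y*z≈x _ _ z ⟩
      m * y                               ∎

  nonvanishing-generator : {P : Vector Carrier n → Set p} {a w : Vector Carrier n} →
                           InSpan P w → ¬ a ⊥ w → ∃ λ v → P v × ¬ a ⊥ v
  nonvanishing-generator {a = a} (k , u , μ , u∈P , w≋) a·w≉0
    with sum-nonzero (λ j → μ j * (a · u j)) (a·w≉0 ∘ trans (trans (·-congʳ a w≋) (·-lincomb a μ u)))
  ... | j , μⱼa·uⱼ≉0 = u j , u∈P j , λ a⊥uⱼ → μⱼa·uⱼ≉0 (trans (*-congˡ a⊥uⱼ) (zeroʳ (μ j)))

  proportional⇒same-kernel : ∀ {a b : Vector Carrier n} {μ} → ¬ μ ≈ 0# → (∀ i → a i ≈ μ * b i) →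
                             ∀ v → (a ⊥ v → b ⊥ v) × (b ⊥ v → a ⊥ v)
  proportional⇒same-kernel {a = a} {b} {μ} μ≉0 a≈μb v =
      (λ a⊥v → zero-product μ≉0 (trans (sym a·v≈μb·v) a⊥v))
    , (λ b⊥v → trans a·v≈μb·v (trans (*-congˡ b⊥v) (zeroʳ μ)))
    where
    a·v≈μb·v : a · v ≈ μ * (b · v)
    a·v≈μb·v = trans (·-congˡ v a≈μb) (·-*ˡ μ b v)

  module _ {n} (a b : Vector Carrier n) {k : Fin n} (bₖ≉0 : ¬ b k ≈ 0#) where
    private
      μ : Carrier
      μ = a k * inv (b k) bₖ≉0

      w : Fin n → Vector Carrier n
      w i j = b k * δ i j + (- b i) * δ k j

      ·-w : ∀ i y → y · w i ≈ b k * y i + (- b i) * y k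
      ·-w i y = begin
        y · w i                                ≈⟨ ·-+ʳ y (λ j → b k * δ i j) (λ j → (- b i) * δ k j) ⟩
        y · (λ j → b k * δ i j) + y · (λ j → (- b i) * δ k j)
          ≈⟨ +-cong (·-*ʳ y (b k) (δ i)) (·-*ʳ y (- b i) (δ k)) ⟩
        b k * (y · δ i) + (- b i) * (y · δ k)  ≈⟨ +-cong (*-congˡ (·-δʳ y i)) (*-congˡ (·-δʳ y k)) ⟩
        b k * y i + (- b i) * y k              ∎

      b⊥w : ∀ i → b ⊥ w i
      b⊥w i = begin
        b · w i                    ≈⟨ ·-w i b ⟩
        b k * b i + (- b i) * b k  ≈⟨ +-congˡ (trans (-‿cong (*-comm (b k) (b i))) (-‿distribˡ-* (b i) (b k))) ⟨
        b k * b i + - (b k * b i)  ≈⟨ -‿inverseʳ _ ⟩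
        0#                         ∎

      a⊥w⇒aᵢ≈μbᵢ : ∀ i → a ⊥ w i → a i ≈ μ * b i
      a⊥w⇒aᵢ≈μbᵢ i a⊥w = *-cancelˡ bₖ≉0 (begin
        b k * a i
          ≈⟨ x∙y⁻¹≈ε⇒x≈y _ _ (trans (+-congˡ (-‿distribˡ-* (b i) (a k))) (trans (sym (·-w i a)) a⊥w)) ⟩
        b i * a k        ≈⟨ *-comm (b i) (a k) ⟩
        a k * b i        ≈⟨ *-congʳ (*-inv-cancelʳ (a k) bₖ≉0) ⟨
        (μ * b k) * b i  ≈⟨ solve 3 (λ M X Y → (M :* X :* Y) := (X :* (M :* Y))) refl μ (b k) (b i) ⟩
        b k * (μ * b i)  ∎)

    separating-or-proportional-at : (∃ λ v → b ⊥ v × ¬ a ⊥ v) ⊎ (∃ λ μ → ∀ i → a i ≈ μ * b i)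
    separating-or-proportional-at with all? (λ i → a i ≟ (μ * b i))
    ... | yes a≈μb = inj₂ (μ , a≈μb)
    ... | no a≉μb with ¬∀⟶∃¬ n _ (λ i → a i ≟ (μ * b i)) a≉μb
    ...   | i , aᵢ≉μbᵢ = inj₁ (w i , b⊥w i , aᵢ≉μbᵢ ∘ a⊥w⇒aᵢ≈μbᵢ i)

  separating-or-proportional : (a b : Vector Carrier n) →
    (∃ λ w → b ⊥ w × ¬ a ⊥ w) ⊎ (∃ λ μ → ∀ i → a i ≈ μ * b i)
  separating-or-proportional a b with all? (λ i → b i ≟ 0#) | all? (λ i → a i ≟ 0#)
  ... | no b≉0  | _ = separating-or-proportional-at a b (proj₂ (¬∀⟶∃¬ _ _ (λ i → b i ≟ 0#) b≉0))
  ... | yes b≈0 | yes a≈0 = inj₂ (0# , λ i → trans (a≈0 i) (sym (zeroˡ (b i))))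
  ... | yes b≈0 | no a≉0 with ¬∀⟶∃¬ _ _ (λ i → a i ≟ 0#) a≉0
  ...   | i , aᵢ≉0 = inj₁ (δ i , trans (·-δʳ b i) (b≈0 i) , aᵢ≉0 ∘ trans (sym (·-δʳ a i)))

  -- T ∩ ker a lies in no hyperplane of ker a.
  Detects : (Vector Carrier n → Set p) → Vector Carrier n → Set (c ⊔ ℓ ⊔ p)
  Detects T a = ∀ b → (∃ λ x → a ⊥ x × ¬ b ⊥ x) → ∃ λ v → T v × a ⊥ v × ¬ b ⊥ v

  -- A test vector x for ker (tail a) is lifted to 0 ∷ x, and b to β b ∷ b, its pullback along π.
  Detects-image : {T : Vector Carrier (suc n) → Set p} {a : Vector Carrier (suc n)}
    (π : Vector Carrier (suc n) → Vector Carrier n) (β : Vector Carrier n → Carrier) →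
    (∀ v → a ⊥ v → tail a ⊥ π v) →
    (∀ b v → a ⊥ v → b · π v ≈ (β b ∷ b) · v) →
    Detects T a → Detects (Image π (T ∩ker a)) (tail a)
  Detects-image {a = a} π β π-ker π-adj detects b (x , tail-a⊥x , ¬b⊥x)
    with detects (β b ∷ b) (0# ∷ x , trans (·-zero-headʳ a (0# ∷ x) refl) tail-a⊥x
                                   , ¬b⊥x ∘ trans (sym (·-zero-headʳ (β b ∷ b) (0# ∷ x) refl)))
  ... | v , Tv , a⊥v , ¬b′⊥v =
    π v , (v , (Tv , a⊥v) , λ _ → refl) , π-ker v a⊥v , ¬b′⊥v ∘ trans (sym (π-adj b v a⊥v))

  InSpan-Image : {π : Vector Carrier m → Vector Carrier n} {P : Vector Carrier m → Set p}
    {Q : Vector Carrier n → Set p′} {w : Vector Carrier n} → (∀ {u} → Q u → Image π P u) → InSpan Q w →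
    Σ ℕ λ k → Σ (Fin k → Vector Carrier m) λ v → Σ (Vector Carrier k) λ μ →
      (∀ j → P (v j)) × w ≋ lincomb μ (π ∘ v)
  InSpan-Image Q⇒Im (k , u , μ , u∈Q , w≋) =
      k , proj₁ ∘ u∈Im , μ , proj₁ ∘ proj₂ ∘ u∈Im
    , λ i → trans (w≋ i) (sum-cong-≋ (λ j → *-congˡ (proj₂ (proj₂ (u∈Im j)) i)))
    where
    u∈Im : ∀ j → Image _ _ (u j)
    u∈Im = Q⇒Im ∘ u∈Q

  module EliminateAlong {T : Vector Carrier (suc n) → Set p} {a : Vector Carrier (suc n)}
    (v₀ : Vector Carrier (suc n)) (v₀∈ : (T ∩ker a) v₀) (v₀₀≉0 : ¬ v₀ zero ≈ 0#) where

    coeff : Vector Carrier (suc n) → Carrier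
    coeff v = v zero * inv (v₀ zero) v₀₀≉0

    ρ : Vector Carrier (suc n) → Vector Carrier (suc n)
    ρ v i = v i + (- coeff v) * v₀ i

    ρ-head : ∀ v → ρ v zero ≈ 0#
    ρ-head v = begin
      v zero + (- coeff v) * v₀ zero    ≈⟨ +-congˡ (-‿distribˡ-* _ _) ⟨
      v zero + - (coeff v * v₀ zero)    ≈⟨ +-congˡ (-‿cong (*-inv-cancelʳ (v zero) v₀₀≉0)) ⟩
      v zero + - v zero                 ≈⟨ -‿inverseʳ _ ⟩
      0#                                ∎

    π : Vector Carrier (suc n) → Vector Carrier n
    π v = tail (ρ v)

    ·-π : ∀ y v → tail y · π v ≈ y · v + (- coeff v) * (y · v₀)
    ·-π y v = trans (sym (·-zero-headʳ y (ρ v) (ρ-head v))) (·-+*ʳ y v _ v₀)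

    β : Vector Carrier n → Carrier
    β b = - ((b · tail v₀) * inv (v₀ zero) v₀₀≉0)

    lift⊥v₀ : ∀ b → (β b ∷ b) ⊥ v₀
    lift⊥v₀ b = begin
      β b * v₀ zero + b · tail v₀  ≈⟨ +-congʳ (-‿distribˡ-* _ _) ⟨
      - (((b · tail v₀) * inv (v₀ zero) v₀₀≉0) * v₀ zero) + b · tail v₀
        ≈⟨ +-congʳ (-‿cong (*-inv-cancelʳ _ v₀₀≉0)) ⟩
      - (b · tail v₀) + b · tail v₀  ≈⟨ -‿inverseˡ _ ⟩
      0#                           ∎

    π-ker : ∀ v → a ⊥ v → tail a ⊥ π v
    π-ker v a⊥v = begin
      tail a · π v                       ≈⟨ ·-π a v ⟩
      a · v + (- coeff v) * (a · v₀)     ≈⟨ +-cong a⊥v (trans (*-congˡ (proj₂ v₀∈)) (zeroʳ _)) ⟩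
      0# + 0#                            ≈⟨ +-identityʳ 0# ⟩
      0#                                 ∎

    π-adj : ∀ b v → a ⊥ v → b · π v ≈ (β b ∷ b) · v
    π-adj b v _ = begin
      b · π v                                        ≈⟨ ·-π (β b ∷ b) v ⟩
      (β b ∷ b) · v + (- coeff v) * ((β b ∷ b) · v₀)
        ≈⟨ +-congˡ (trans (*-congˡ (lift⊥v₀ b)) (zeroʳ _)) ⟩
      (β b ∷ b) · v + 0#                             ≈⟨ +-identityʳ _ ⟩
      (β b ∷ b) · v                                  ∎

    -- Lifting π w ≈ Σ μⱼ π vⱼ gives w ≈ (coeff w − Σ μⱼ coeff vⱼ) v₀ + Σ μⱼ vⱼ.
    lift-span : ∀ w → InSpan (Image π (T ∩ker a) ∩ker tail a) (π w) → InSpan (T ∩ker a) w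
    lift-span w span with InSpan-Image {Q = Image π (T ∩ker a) ∩ker tail a} proj₁ span
    ... | k , v , μ , v∈ , πw≋ = suc k , v₀ ∷ v , d ∷ μ , (λ { zero → v₀∈ ; (suc j) → v∈ j }) , w≋
      where
      S = sum (λ j → μ j * coeff (v j))
      d = coeff w + - S

      ρw≋ : ρ w ≋ lincomb μ (ρ ∘ v)
      ρw≋ zero = trans (ρ-head w) (sym (sum-zero (λ j → trans (*-congˡ (ρ-head (v j))) (zeroʳ (μ j)))))
      ρw≋ (suc i) = πw≋ i

      w≋ : ∀ i → w i ≈ d * v₀ i + lincomb μ v i
      w≋ i = begin
        w i                                   ≈⟨ x+-y*z+y*z≈x (w i) (coeff w) (v₀ i) ⟨
        ρ w i + coeff w * v₀ i                ≈⟨ +-congʳ (ρw≋ i) ⟩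
        R + coeff w * v₀ i                    ≈⟨ x+-y*z+y*z≈x _ S (v₀ i) ⟨
        R + coeff w * v₀ i + (- S) * v₀ i + S * v₀ i
          ≈⟨ solve 5 (λ R′ C S′ S″ Z → (R′ :+ C :* Z :+ S″ :* Z :+ S′ :* Z)
                                      := ((C :+ S″) :* Z :+ (R′ :+ S′ :* Z)))
                   refl R (coeff w) S (- S) (v₀ i) ⟩
        d * v₀ i + (R + S * v₀ i)
          ≈⟨ +-congˡ (sum-lincomb-shift μ (coeff ∘ v) (λ j → v j i) (v₀ i)) ⟩
        d * v₀ i + lincomb μ v i              ∎
        where R = lincomb μ (ρ ∘ v) i

  module EliminateHead {T : Vector Carrier (suc n) → Set p} {a : Vector Carrier (suc n)}
    (ker⇒head≈0 : ∀ x → a ⊥ x → x zero ≈ 0#) where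

    π-ker : ∀ v → a ⊥ v → tail a ⊥ tail v
    π-ker v a⊥v = trans (sym (·-zero-headʳ a v (ker⇒head≈0 v a⊥v))) a⊥v

    π-adj : ∀ b v → a ⊥ v → b · tail v ≈ (0# ∷ b) · v
    π-adj b v a⊥v = sym (·-zero-headʳ (0# ∷ b) v (ker⇒head≈0 v a⊥v))

    lift-span : ∀ w → a ⊥ w → InSpan (Image tail (T ∩ker a) ∩ker tail a) (tail w) → InSpan (T ∩ker a) w
    lift-span w a⊥w span with InSpan-Image {Q = Image tail (T ∩ker a) ∩ker tail a} proj₁ span
    ... | k , v , μ , v∈ , tail-w≋ = k , v , μ , v∈ , w≋
      where
      w≋ : w ≋ lincomb μ v
      w≋ zero = trans (ker⇒head≈0 w a⊥w)
                      (sym (sum-zero (λ j → trans (*-congˡ (ker⇒head≈0 (v j) (proj₂ (v∈ j)))) (zeroʳ (μ j)))))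
      w≋ (suc i) = tail-w≋ i

  detects⇒spans : {T : Vector Carrier n → Set p} {a : Vector Carrier n} →
                  Detects T a → ∀ w → a ⊥ w → InSpan (T ∩ker a) w
  detects⇒spans {zero} _ _ _ = 0 , (λ ()) , (λ ()) , (λ ()) , λ ()
  detects⇒spans {suc n} {T = T} {a} detects w a⊥w with separating-or-proportional (δ zero) a
  ... | inj₁ x-witness with detects (δ zero) x-witness
  ...   | v₀ , Tv₀ , a⊥v₀ , ¬δ⊥v₀ = lift-span w (detects⇒spans detects′ (π w) (π-ker w a⊥w))
    where
    open EliminateAlong {T = T} {a} v₀ (Tv₀ , a⊥v₀) (¬δ⊥v₀ ∘ trans (·-δˡ zero v₀))
    detects′ : Detects (Image π (T ∩ker a)) (tail a)
    detects′ = Detects-image {a = a} π β π-ker π-adj detects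
  detects⇒spans {suc n} {T = T} {a} detects w a⊥w | inj₂ (μ , δ≈μa) =
    lift-span w a⊥w (detects⇒spans detects′ (tail w) (π-ker w a⊥w))
    where
    ker⇒head≈0 : ∀ x → a ⊥ x → x zero ≈ 0#
    ker⇒head≈0 x a⊥x = begin
      x zero               ≈⟨ ·-δˡ zero x ⟨
      δ zero · x           ≈⟨ ·-congˡ x δ≈μa ⟩
      (λ i → μ * a i) · x  ≈⟨ ·-*ˡ μ a x ⟩
      μ * (a · x)          ≈⟨ *-congˡ a⊥x ⟩
      μ * 0#               ≈⟨ zeroʳ μ ⟩
      0#                   ∎
    open EliminateHead {T = T} {a} ker⇒head≈0
    detects′ : Detects (Image tail (T ∩ker a)) (tail a)
    detects′ = Detects-image {a = a} tail (λ _ → 0#) π-ker π-adj detects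

module Hyperplanes {c ℓ} (F : Field c ℓ) (_≟_ : Decidable (Field._≈_ F)) (N : ℕ) where
  open Field F hiding (zero)
  open LinearAlgebra F _≟_
  open import Algebra.Properties.Semiring.Sum semiring using (sum)
  open Proj F N using (V; Σᶠ; OnHyp; IsHyperplane; SameHyperplane; IsCutting; AffineBlocking)
    renaming (InSpan to InSpanᴾ)

  _∩_ : ∀ {p} → (V → Set p) → V → V → Set (ℓ ⊔ p)
  (S ∩ a) v = S v × OnHyp a v

  Σᶠ≡sum : ∀ {k} (f : Vector Carrier k) → Σᶠ f ≡ sum f
  Σᶠ≡sum {zero}  f = ≡-refl
  Σᶠ≡sum {suc k} f = cong (f zero +_) (Σᶠ≡sum (tail f))

  OnHyp⇒⊥ : ∀ a v → OnHyp a v → a ⊥ v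
  OnHyp⇒⊥ a v = subst (_≈ 0#) (Σᶠ≡sum (λ i → a i * v i))

  ⊥⇒OnHyp : ∀ a v → a ⊥ v → OnHyp a v
  ⊥⇒OnHyp a v = subst (_≈ 0#) (≡-sym (Σᶠ≡sum (λ i → a i * v i)))

  fromInSpanᴾ : ∀ {p} (P : V → Set p) {w} → InSpanᴾ P w → InSpan P w
  fromInSpanᴾ _ (k , u , μ , u∈P , w≈) =
    k , u , μ , u∈P , λ i → trans (w≈ i) (reflexive (Σᶠ≡sum (λ j → μ j * u j i)))

  toInSpanᴾ : ∀ {p} (P : V → Set p) {w} → InSpan P w → InSpanᴾ P w
  toInSpanᴾ _ (k , u , μ , u∈P , w≋) =
    k , u , μ , u∈P , λ i → trans (w≋ i) (reflexive (≡-sym (Σᶠ≡sum (λ j → μ j * u j i))))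

  cutting⇒affineBlocking : ∀ {p} {S : V → Set p} → IsCutting S → ∀ a → IsHyperplane a → AffineBlocking S a
  cutting⇒affineBlocking {S = S} cut a a≉0 b b≉0 a≠b with separating-or-proportional a b
  ... | inj₂ (μ , a≈μb) = ⊥-elim (a≠b λ v _ → OnHyp-iff v (proportional⇒same-kernel μ≉0 a≈μb v))
    where
    μ≉0 : ¬ μ ≈ 0#
    μ≉0 μ≈0 = a≉0 (λ i → trans (a≈μb i) (trans (*-congʳ μ≈0) (zeroˡ _)))
    OnHyp-iff : ∀ v → (a ⊥ v → b ⊥ v) × (b ⊥ v → a ⊥ v) →
                (OnHyp a v → OnHyp b v) × (OnHyp b v → OnHyp a v)
    OnHyp-iff v (a⇒b , b⇒a) = ⊥⇒OnHyp b v ∘ a⇒b ∘ OnHyp⇒⊥ a v , ⊥⇒OnHyp a v ∘ b⇒a ∘ OnHyp⇒⊥ b v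
  ... | inj₁ (w , b⊥w , ¬a⊥w) =
    let v , (Sv , v∈Hb) , ¬a⊥v =
          nonvanishing-generator {P = S ∩ b} {a} (fromInSpanᴾ (S ∩ b) (cut b b≉0 w (⊥⇒OnHyp b w b⊥w))) ¬a⊥w
    in v , Sv , ¬a⊥v ∘ OnHyp⇒⊥ a v , v∈Hb

  affineBlocking⇒cutting : ∀ {p} {S : V → Set p} → (∀ a → IsHyperplane a → AffineBlocking S a) → IsCutting S
  affineBlocking⇒cutting {S = S} blocking a a≉0 w w∈Ha =
    toInSpanᴾ (S ∩ a) (InSpan-mono {P = S ∩ker a} (λ {v} → map₂ (⊥⇒OnHyp a v))
                                   (detects⇒spans {a = a} detects w (OnHyp⇒⊥ a w w∈Ha)))
    where
    detects : Detects S a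
    detects b (x , a⊥x , ¬b⊥x) =
      let v , Sv , v∉Hb , v∈Ha = blocking b b≉0 a a≉0 b≠a
      in  v , Sv , OnHyp⇒⊥ a v v∈Ha , v∉Hb ∘ ⊥⇒OnHyp b v
      where
      b≉0 : IsHyperplane b
      b≉0 = ¬b⊥x ∘ ·-zeroˡ x
      b≠a : ¬ SameHyperplane b a
      b≠a same = ¬b⊥x (OnHyp⇒⊥ b x (proj₂ (same x (¬b⊥x ∘ ·-zeroʳ b)) (⊥⇒OnHyp a x a⊥x)))

proposition3p4 : ∀ {c ℓ p} (F : Field c ℓ) (q : ℕ) → HasOrder F q → (N : ℕ)
                 → (S : Proj.V F N → Set p) → Proj.IsPointSet F N S
                 → (Proj.IsCutting F N S → (∀ a → Proj.IsHyperplane F N a → Proj.AffineBlocking F N S a))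
                   × ((∀ a → Proj.IsHyperplane F N a → Proj.AffineBlocking F N S a) → Proj.IsCutting F N S)
proposition3p4 F q H N S _ = cutting⇒affineBlocking , affineBlocking⇒cutting
  where open Hyperplanes F (finite⇒decidable H) N
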